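{- Let $h \geq 1$ be an integer and let $0 = a_0(h) < a_1(h) < a_2(h) < a_3(h) < \cdots$ be the greedy $B_h$-set (so that $a_1(h) = 1$ and $a_2(h) = h+1$). Then \[ a_3(h) = h^2 + h + 1. \]
   Context: For an integer $h \geq 1$, a set $A$ of nonnegative integers is a $B_h$-set if every integer $n$ has at most one representation $n = a_{i_1} + a_{i_2} + \cdots + a_{i_h}$ with $a_{i_1}, \ldots, a_{i_h} \in A$ and $a_{i_1} \leq a_{i_2} \leq \cdots \leq a_{i_h}$ (i.e. at most one representation as a sum of $h$ not necessarily distinct elements of $A$, up to reordering of the summands). The greedy $B_h$-set $\{a_0(h), a_1(h), a_2(h), \ldots\}$ is defined inductively: $a_0(h) = 0$, and for $k \geq 1$, given the $B_h$-set $\{a_0(h), \ldots, a_{k-1}(h)\}$ with $a_0(h) < \cdots < a_{k-1}(h)$, $a_k(h)$ is the smallest integer with $a_k(h) > a_{k-1}(h)$ such that $\{a_0(h), \ldots, a_{k-1}(h), a_k(h)\}$ is a $B_h$-set. The element $a_k(h)$ is called the $k$th positive element of the greedy $B_h$-set. -}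

module Defs where

open import Data.Nat using (ℕ; zero; suc; _+_; _≤_; _<_)
open import Data.Fin using (Fin) renaming (_≤_ to _≤ᶠ_)
open import Data.Vec.Functional using (Vector; foldr)
open import Data.Product using (Σ; _×_; ∃-syntax)
open import Data.Sum using (_⊎_)
open import Relation.Nullary using (¬_)
open import Relation.Binary.PropositionalEquality using (_≡_)

Subset : Set₁
Subset = ℕ → Set

vsum : ∀ {h} → Vector ℕ h → ℕ
vsum = foldr _+_ 0

-- A representation (up to reordering) of a number as a sum of h elements
-- of A: a nondecreasing h-tuple a_{i_1} ≤ ... ≤ a_{i_h} of elements of A.
IsRep : (A : Subset) (h : ℕ) → Vector ℕ h → Set
IsRep A h u = (∀ i → A (u i)) × (∀ (i j : Fin h) → i ≤ᶠ j → u i ≤ u j)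

IsBh : ℕ → Subset → Set
IsBh h A = ∀ (u v : Vector ℕ h) → IsRep A h u → IsRep A h v →
           vsum u ≡ vsum v → ∀ i → u i ≡ v i

prefix : (ℕ → ℕ) → ℕ → Subset
prefix a k n = ∃[ i ] (i ≤ k × a i ≡ n)

prefixWith : (ℕ → ℕ) → ℕ → ℕ → Subset
prefixWith a k x n = prefix a k n ⊎ x ≡ n

IsGreedyBh : ℕ → (ℕ → ℕ) → Set
IsGreedyBh h a =
  (a 0 ≡ 0) ×
  (∀ k → a k < a (suc k)) ×
  (∀ k → IsBh h (prefix a (suc k))) ×
  (∀ k x → a k < x → x < a (suc k) → ¬ IsBh h (prefixWith a k x))

-- Every element of {0, 1, h+1, h²+h+1} exceeds h times each smaller one, and in such a set two
-- representations with equal sums must have equal largest summands; peeling these off shows the set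
-- is B_h, so the greedy choice never overshoots these values. Conversely every smaller candidate y
-- has two representations (padded with zeros) with different largest summands: for 1 < y ≤ h,
-- y is both y and 1 + ⋯ + 1; for h+1 < y ≤ h(h+1), write y = r + q(h+1) with r ≤ h, and either
-- y is also r·1 + q·(h+1) (when q + r ≤ h), or else (q+1)(h+1) is both (h+1−r)·1 + y and
-- (q+1)·(h+1).

module Submission where

open import Defs
open import Data.Nat using (ℕ; zero; suc; _+_; _*_; _∸_; _≤_; _<_; z≤n; s≤s; s≤s⁻¹; _≤?_)
open import Data.Nat.Properties
open import Data.Nat.DivMod using (_/_; _%_; m≡m%n+[m/n]*n; m%n<n)
open import Data.Fin using (Fin; zero; suc; fromℕ; inject₁) renaming (_≤_ to _≤ᶠ_)
open import Data.Fin.Properties using (≤fromℕ; toℕ-inject₁)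
open import Data.Vec.Functional using (Vector; init; last)
open import Data.Product using (_×_; _,_; proj₁)
open import Data.Sum using (_⊎_; inj₁; inj₂)
open import Relation.Nullary using (¬_; contradiction; yes; no)
open import Relation.Unary using (_⊆_)
open import Relation.Binary.Definitions using (tri<; tri≈; tri>)
open import Relation.Binary.PropositionalEquality
open import Data.Nat.Tactic.RingSolver using (solve-∀)
open import Function using (_∘_)

vsum-init-last : ∀ {n} (u : Vector ℕ (suc n)) → vsum u ≡ vsum (init u) + last u
vsum-init-last {zero}  u = +-comm (u zero) 0
vsum-init-last {suc n} u = begin
  u zero + vsum (λ i → u (suc i))                       ≡⟨ cong (u zero +_) (vsum-init-last (λ i → u (suc i))) ⟩
  u zero + (vsum (λ i → u (suc (inject₁ i))) + last u)  ≡⟨ +-assoc (u zero) _ (last u) ⟨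
  vsum (init u) + last u                                ∎
  where open ≡-Reasoning

vsum-≤ : ∀ {n} (u : Vector ℕ n) {b} → (∀ i → u i ≤ b) → vsum u ≤ n * b
vsum-≤ {zero}  u u≤b = z≤n
vsum-≤ {suc n} u u≤b = +-mono-≤ (u≤b zero) (vsum-≤ (λ i → u (suc i)) (λ i → u≤b (suc i)))

init-last-≗ : ∀ {n} {u v : Vector ℕ (suc n)} → init u ≗ init v → last u ≡ last v → u ≗ v
init-last-≗ {zero}  init≗ last≡ zero    = last≡
init-last-≗ {suc n} init≗ last≡ zero    = init≗ zero
init-last-≗ {suc n} init≗ last≡ (suc i) = init-last-≗ (λ j → init≗ (suc j)) last≡ i

IsRep-init : ∀ {A n u} → IsRep A (suc n) u → IsRep A n (init u)
IsRep-init (u∈A , u↑) =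
  (λ i → u∈A (inject₁ i)) , (λ i j i≤j → u↑ (inject₁ i) (inject₁ j) (inject₁-mono i≤j))
  where
  inject₁-mono : ∀ {n} {i j : Fin n} → i ≤ᶠ j → inject₁ i ≤ᶠ inject₁ j
  inject₁-mono {i = i} {j} = subst₂ _≤_ (sym (toℕ-inject₁ i)) (sym (toℕ-inject₁ j))

IsRep-≤-last : ∀ {A n u} → IsRep A (suc n) u → ∀ i → u i ≤ last u
IsRep-≤-last (_ , u↑) i = u↑ i _ (≤fromℕ i)

Bh-⊆ : ∀ {h} {S T : Subset} → S ⊆ T → IsBh h T → IsBh h S
Bh-⊆ S⊆T bh u v (u∈S , u↑) (v∈S , v↑) = bh u v ((λ i → S⊆T (u∈S i)) , u↑) ((λ i → S⊆T (v∈S i)) , v↑)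

last-≤-vsum : ∀ {n} (u : Vector ℕ (suc n)) → last u ≤ vsum u
last-≤-vsum u = subst (last u ≤_) (sym (vsum-init-last u)) (m≤n+m (last u) (vsum (init u)))

Separated : ℕ → Subset → Set
Separated c S = ∀ {s t} → S s → S t → s < t → c * s < t

separated-vsum-< : ∀ {c S n u v} → Separated c S → suc n ≤ c → IsRep S (suc n) u → IsRep S (suc n) v →
                   last u < last v → vsum u < vsum v
separated-vsum-< {c} {S} {n} {u} {v} sep n<c ru rv lu<lv = begin-strict
  vsum u         ≤⟨ vsum-≤ u (IsRep-≤-last {S} ru) ⟩
  suc n * last u ≤⟨ *-monoˡ-≤ (last u) n<c ⟩
  c * last u     <⟨ sep (proj₁ ru _) (proj₁ rv _) lu<lv ⟩
  last v         ≤⟨ last-≤-vsum v ⟩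
  vsum v         ∎
  where open ≤-Reasoning

separated⇒Bh : ∀ {c S n} → Separated c S → n ≤ c → IsBh n S
separated⇒Bh {n = zero}  _   _   _ _ _  _  _   ()
separated⇒Bh {S = S} {suc n} sep n<c u v ru rv Σu≡Σv = init-last-≗ init≗ last≡
  where
  last≡ : last u ≡ last v
  last≡ with <-cmp (last u) (last v)
  ... | tri< lu<lv _ _ = contradiction Σu≡Σv (<⇒≢ (separated-vsum-< sep n<c ru rv lu<lv))
  ... | tri≈ _ lu≡lv _ = lu≡lv
  ... | tri> _ _ lv<lu = contradiction Σu≡Σv (>⇒≢ (separated-vsum-< sep n<c rv ru lv<lu))
  Σinit≡ : vsum (init u) ≡ vsum (init v)
  Σinit≡ = +-cancelʳ-≡ (last u) _ _ (begin
    vsum (init u) + last u ≡⟨ vsum-init-last u ⟨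
    vsum u                 ≡⟨ Σu≡Σv ⟩
    vsum v                 ≡⟨ vsum-init-last v ⟩
    vsum (init v) + last v ≡⟨ cong (vsum (init v) +_) last≡ ⟨
    vsum (init v) + last u ∎)
    where open ≡-Reasoning
  init≗ : init u ≗ init v
  init≗ = separated⇒Bh sep (<⇒≤ n<c) (init u) (init v) (IsRep-init {S} ru) (IsRep-init {S} rv) Σinit≡

data Candidate (h : ℕ) : ℕ → Set where
  ∋0      : Candidate h 0
  ∋1      : Candidate h 1
  ∋1+h    : Candidate h (suc h)
  ∋h²+h+1 : Candidate h (h * h + h + 1)

n*n+n+1≡1+n*[1+n] : ∀ n → n * n + n + 1 ≡ suc (n * suc n)
n*n+n+1≡1+n*[1+n] = solve-∀

n*[1+n]<n*n+n+1 : ∀ n → n * suc n < n * n + n + 1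
n*[1+n]<n*n+n+1 n = ≤-reflexive (sym (n*n+n+1≡1+n*[1+n] n))

n<n*n+n+1 : ∀ n → n < n * n + n + 1
n<n*n+n+1 n = ≤-<-trans (m≤m*n n (suc n)) (n*[1+n]<n*n+n+1 n)

candidate-ordered : ∀ {h s t} → Candidate h s → Candidate h t → h * s < t ⊎ t ≤ s
candidate-ordered     ∋0      ∋0      = inj₂ z≤n
candidate-ordered {h} ∋0      ∋1      rewrite *-zeroʳ h = inj₁ (s≤s z≤n)
candidate-ordered {h} ∋0      ∋1+h    rewrite *-zeroʳ h = inj₁ (s≤s z≤n)
candidate-ordered {h} ∋0      ∋h²+h+1 rewrite *-zeroʳ h = inj₁ (m≤n+m 1 (h * h + h))
candidate-ordered     ∋1      ∋0      = inj₂ z≤n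
candidate-ordered     ∋1      ∋1      = inj₂ ≤-refl
candidate-ordered {h} ∋1      ∋1+h    rewrite *-identityʳ h = inj₁ (n<1+n h)
candidate-ordered {h} ∋1      ∋h²+h+1 rewrite *-identityʳ h = inj₁ (n<n*n+n+1 h)
candidate-ordered     ∋1+h    ∋0      = inj₂ z≤n
candidate-ordered     ∋1+h    ∋1      = inj₂ (s≤s z≤n)
candidate-ordered     ∋1+h    ∋1+h    = inj₂ ≤-refl
candidate-ordered {h} ∋1+h    ∋h²+h+1 = inj₁ (n*[1+n]<n*n+n+1 h)
candidate-ordered     ∋h²+h+1 ∋0      = inj₂ z≤n
candidate-ordered {h} ∋h²+h+1 ∋1      = inj₂ (m≤n+m 1 (h * h + h))
candidate-ordered {h} ∋h²+h+1 ∋1+h    = inj₂ (n<n*n+n+1 h)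
candidate-ordered     ∋h²+h+1 ∋h²+h+1 = inj₂ ≤-refl

candidate-separated : ∀ {h} → Separated h (Candidate h)
candidate-separated s∈ t∈ s<t with candidate-ordered s∈ t∈
... | inj₁ hs<t = hs<t
... | inj₂ t≤s  = contradiction t≤s (<⇒≱ s<t)

prefixWith-⊆ : ∀ {P : Subset} {a : ℕ → ℕ} {k x} → (∀ i → i ≤ k → P (a i)) → P x → prefixWith a k x ⊆ P
prefixWith-⊆ Pa Px (inj₁ (i , i≤k , refl)) = Pa i i≤k
prefixWith-⊆ Pa Px (inj₂ refl)             = Px

candidates-Bh : ∀ {h} {a : ℕ → ℕ} {k x} → (∀ i → i ≤ k → Candidate h (a i)) → Candidate h x →
                IsBh h (prefixWith a k x)
candidates-Bh {a = a} {k} {x} Ca Cx =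
  Bh-⊆ {S = prefixWith a k x} (prefixWith-⊆ Ca Cx) (separated⇒Bh candidate-separated ≤-refl)

prefixWith-next⊆prefix : ∀ {a : ℕ → ℕ} {k} → prefixWith a k (a (suc k)) ⊆ prefix a (suc k)
prefixWith-next⊆prefix (inj₁ (i , i≤k , e)) = i , m≤n⇒m≤1+n i≤k , e
prefixWith-next⊆prefix {k = k} (inj₂ e)     = suc k , ≤-refl , e

greedy-next : ∀ {h} {a : ℕ → ℕ} → IsGreedyBh h a → ∀ k {x} → a k < x → IsBh h (prefixWith a k x) →
              (∀ {y} → a k < y → y < x → ¬ IsBh h (prefixWith a k y)) → a (suc k) ≡ x
greedy-next {a = a} (_ , a↑ , bh , greedy) k ak<x x-ok below-x = ≤-antisym
  (≮⇒≥ λ x<a → greedy k _ ak<x x<a x-ok)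
  (≮⇒≥ λ a<x → below-x (a↑ k) a<x
                 (Bh-⊆ {S = prefixWith a k (a (suc k))} prefixWith-next⊆prefix (bh k)))

-- padded y z n c₀ c₁ is 0,…,0 (c₀ times), y,…,y (c₁ times), then z up to length n.
padded : ℕ → ℕ → ∀ n → ℕ → ℕ → Vector ℕ n
padded y z _       zero     zero     _       = z
padded y z (suc n) (suc c₀) c₁       zero    = 0
padded y z (suc n) (suc c₀) c₁       (suc i) = padded y z n c₀ c₁ i
padded y z (suc n) zero     (suc c₁) zero    = y
padded y z (suc n) zero     (suc c₁) (suc i) = padded y z n zero c₁ i

module _ {y z : ℕ} where

  padded-∈ : ∀ {P : Subset} → P 0 → P y → P z → ∀ n c₀ c₁ i → P (padded y z n c₀ c₁ i)
  padded-∈ P0 Py Pz _       zero     zero     _       = Pz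
  padded-∈ P0 Py Pz (suc n) (suc c₀) c₁       zero    = P0
  padded-∈ P0 Py Pz (suc n) (suc c₀) c₁       (suc i) = padded-∈ P0 Py Pz n c₀ c₁ i
  padded-∈ P0 Py Pz (suc n) zero     (suc c₁) zero    = Py
  padded-∈ P0 Py Pz (suc n) zero     (suc c₁) (suc i) = padded-∈ P0 Py Pz n zero c₁ i

  ≤-padded : y ≤ z → ∀ n c₁ i → y ≤ padded y z n zero c₁ i
  ≤-padded y≤z _       zero     _       = y≤z
  ≤-padded y≤z (suc n) (suc c₁) zero    = ≤-refl
  ≤-padded y≤z (suc n) (suc c₁) (suc i) = ≤-padded y≤z n c₁ i

  padded-mono : y ≤ z → ∀ n c₀ c₁ (i j : Fin n) → i ≤ᶠ j → padded y z n c₀ c₁ i ≤ padded y z n c₀ c₁ j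
  padded-mono y≤z _       zero     zero     _       _       _         = ≤-refl
  padded-mono y≤z (suc n) (suc c₀) c₁       zero    _       _         = z≤n
  padded-mono y≤z (suc n) (suc c₀) c₁       (suc i) (suc j) (s≤s i≤j) = padded-mono y≤z n c₀ c₁ i j i≤j
  padded-mono y≤z (suc n) zero     (suc c₁) zero    j       _         = ≤-padded y≤z (suc n) (suc c₁) j
  padded-mono y≤z (suc n) zero     (suc c₁) (suc i) (suc j) (s≤s i≤j) = padded-mono y≤z n zero c₁ i j i≤j

  vsum-const : ∀ n → vsum {n} (λ _ → z) ≡ n * z
  vsum-const zero    = refl
  vsum-const (suc n) = cong (z +_) (vsum-const n)

  padded-sum : ∀ {n} c₀ c₁ c₂ → c₀ + c₁ + c₂ ≡ n → vsum (padded y z n c₀ c₁) ≡ c₁ * y + c₂ * z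
  padded-sum         zero     zero     c₂ refl = vsum-const c₂
  padded-sum {suc n} (suc c₀) c₁       c₂ e    = padded-sum c₀ c₁ c₂ (suc-injective e)
  padded-sum {suc n} zero     (suc c₁) c₂ e    =
    trans (cong (y +_) (padded-sum zero c₁ c₂ (suc-injective e))) (sym (+-assoc y (c₁ * y) (c₂ * z)))

  padded-last : ∀ {n} c₀ c₁ c₂ → c₀ + c₁ + c₂ ≡ n → last (padded y z (suc n) c₀ c₁) ≡ z
  padded-last         zero     zero     c₂ _ = refl
  padded-last {suc n} (suc c₀) c₁       c₂ e = padded-last c₀ c₁ c₂ (suc-injective e)
  padded-last {suc n} zero     (suc c₁) c₂ e = padded-last zero c₁ c₂ (suc-injective e)

record RepWithTop (P : Subset) (n s t : ℕ) : Set where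
  constructor repWithTop
  field
    vector : Vector ℕ (suc n)
    isRep  : IsRep P (suc n) vector
    sum≡   : vsum vector ≡ s
    last≡  : last vector ≡ t

distinct-tops⇒¬Bh : ∀ {P n s t t′} → RepWithTop P n s t → RepWithTop P n s t′ → t ≢ t′ → ¬ IsBh (suc n) P
distinct-tops⇒¬Bh {n = n} (repWithTop u ru Σu lu) (repWithTop v rv Σv lv) t≢t′ bh =
  t≢t′ (trans (sym lu) (trans (bh u v ru rv (trans Σu (sym Σv)) (fromℕ n)) lv))

padded-rep : ∀ {P : Subset} {y z n s} → P 0 → P y → P z → y ≤ z →
             ∀ c₀ c₁ c₂ → c₀ + c₁ + c₂ ≡ n → c₁ * y + suc c₂ * z ≡ s → RepWithTop P n s z
padded-rep {P} {y} {z} {n} P0 Py Pz y≤z c₀ c₁ c₂ counts sum =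
  repWithTop (padded y z (suc n) c₀ c₁)
    (padded-∈ {P = P} P0 Py Pz (suc n) c₀ c₁ , padded-mono y≤z (suc n) c₀ c₁)
    (trans (padded-sum c₀ c₁ (suc c₂) (trans (+-suc (c₀ + c₁) c₂) (cong suc counts))) sum)
    (padded-last c₀ c₁ c₂ counts)

singleton-rep : ∀ {P : Subset} {y} n → P 0 → P y → RepWithTop P n y y
singleton-rep {P} {y} n P0 Py =
  padded-rep P0 Py Py ≤-refl n 0 0 (trans (+-identityʳ (n + 0)) (+-identityʳ n)) (+-identityʳ y)

¬Bh-small : ∀ {P : Subset} {m y} → P 0 → P 1 → P y → 1 < y → y ≤ suc m → ¬ IsBh (suc m) P
¬Bh-small {P} {m} {suc k} P0 P1 Py (s≤s (s≤s z≤n)) y≤1+m =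
  distinct-tops⇒¬Bh (singleton-rep m P0 Py) ones (λ ())
  where
  ones : RepWithTop P m (suc k) 1
  ones = padded-rep P0 P1 P1 ≤-refl (m ∸ k) 0 k
           (trans (cong (_+ k) (+-identityʳ (m ∸ k))) (m∸n+n≡m (s≤s⁻¹ y≤1+m))) (*-identityʳ (suc k))

¬Bh-fits : ∀ {P : Subset} {m y} q r → P 0 → P 1 → P (2 + m) → P y → 2 + m < y →
           y ≡ r + suc q * (2 + m) → suc q + r ≤ suc m → ¬ IsBh (suc m) P
¬Bh-fits {P} {m} {y} q r P0 P1 P2+m Py 2+m<y y≡ fits =
  distinct-tops⇒¬Bh (singleton-rep m P0 Py) digits (>⇒≢ 2+m<y)
  where
  d = suc m ∸ (suc q + r)
  reorder : ∀ d q r → suc (d + r + q) ≡ d + (suc q + r)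
  reorder = solve-∀
  digits : RepWithTop P m y (2 + m)
  digits = padded-rep P0 P1 P2+m (s≤s z≤n) d r q
             (suc-injective (trans (reorder d q r) (m∸n+n≡m fits)))
             (trans (cong (_+ suc q * (2 + m)) (*-identityʳ r)) (sym y≡))

¬Bh-overflows : ∀ {P : Subset} {m y} q r → P 0 → P 1 → P (2 + m) → P y → 2 + m < y →
                y ≡ 2 + r + q * (2 + m) → r ≤ m → q ≤ m → ¬ IsBh (suc m) P
¬Bh-overflows {P} {m} {y} q r P0 P1 P2+m Py 2+m<y y≡ r≤m q≤m =
  distinct-tops⇒¬Bh via-y via-2+m (<⇒≢ 2+m<y ∘ sym)
  where
  via-y : RepWithTop P m (suc q * (2 + m)) y
  via-y = padded-rep P0 P1 Py (≤-trans (s≤s z≤n) 2+m<y) r (m ∸ r) 0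
            (trans (+-identityʳ _) (m+[n∸m]≡n r≤m)) (begin
    (m ∸ r) * 1 + 1 * y                ≡⟨ unit (m ∸ r) y ⟩
    (m ∸ r) + y                        ≡⟨ cong ((m ∸ r) +_) y≡ ⟩
    (m ∸ r) + (2 + r + q * (2 + m))    ≡⟨ regroup (m ∸ r) r (q * (2 + m)) ⟩
    2 + ((m ∸ r) + r) + q * (2 + m)    ≡⟨ cong (λ k → 2 + k + q * (2 + m)) (m∸n+n≡m r≤m) ⟩
    suc q * (2 + m)                    ∎)
    where
    open ≡-Reasoning
    unit : ∀ d y → d * 1 + 1 * y ≡ d + y
    unit = solve-∀
    regroup : ∀ d r e → d + (2 + r + e) ≡ 2 + (d + r) + e
    regroup = solve-∀
  via-2+m : RepWithTop P m (suc q * (2 + m)) (2 + m)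
  via-2+m = padded-rep P0 P2+m P2+m ≤-refl (m ∸ q) 0 q
              (trans (cong (_+ q) (+-identityʳ (m ∸ q))) (m∸n+n≡m q≤m)) refl

overflow-digits : ∀ {m q r} → r + suc q * (2 + m) ≤ suc m * (2 + m) → ¬ (suc q + r ≤ suc m) →
                  suc q ≤ m × 2 ≤ r
overflow-digits {m} {q} {r} y≤ ¬fits = q<m , 2≤r
  where
  q≤m : q ≤ m
  q≤m = s≤s⁻¹ (*-cancelʳ-≤ (suc q) (suc m) (2 + m) (≤-trans (m≤n+m _ r) y≤))
  q≢m : q ≢ m
  q≢m refl = ¬fits (≤-reflexive (trans (cong (suc q +_) r≡0) (+-identityʳ (suc q))))
    where
    r≡0 : r ≡ 0
    r≡0 = n≤0⇒n≡0 (+-cancelʳ-≤ (suc q * (2 + m)) r 0 y≤)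
  q<m : suc q ≤ m
  q<m = ≤∧≢⇒< q≤m q≢m
  2≤r : 2 ≤ r
  2≤r = +-cancelˡ-≤ m 2 r (begin
    m + 2     ≡⟨ +-comm m 2 ⟩
    2 + m     ≤⟨ ≰⇒> ¬fits ⟩
    suc q + r ≤⟨ +-monoˡ-≤ r q<m ⟩
    m + r     ∎)
    where open ≤-Reasoning

¬Bh-middle : ∀ {P : Subset} {m y} → P 0 → P 1 → P (2 + m) → P y → 2 + m < y → y ≤ suc m * (2 + m) →
             ¬ IsBh (suc m) P
¬Bh-middle {P} {m} {y} P0 P1 P2+m Py 2+m<y y≤ =
  by-digits (y / (2 + m)) (y % (2 + m)) (m≡m%n+[m/n]*n y (2 + m)) (s≤s⁻¹ (m%n<n y (2 + m)))
  where
  by-digits : ∀ q r → y ≡ r + q * (2 + m) → r ≤ suc m → ¬ IsBh (suc m) P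
  by-digits zero    r y≡ r≤ =
    contradiction (≤-trans (≤-reflexive (trans y≡ (+-identityʳ r))) r≤) (<⇒≱ (<-trans (n<1+n (suc m)) 2+m<y))
  by-digits (suc q) r y≡ r≤ with suc q + r ≤? suc m
  ... | yes fits = ¬Bh-fits q r P0 P1 P2+m Py 2+m<y y≡ fits
  ... | no ¬fits with overflow-digits (subst (_≤ suc m * (2 + m)) y≡ y≤) ¬fits
  ...   | q<m , 2≤r@(s≤s (s≤s {n = r′} _)) = ¬Bh-overflows (suc q) r′ P0 P1 P2+m Py 2+m<y y≡ r′≤m q<m
    where
    r′≤m : r′ ≤ m
    r′≤m = ≤-trans (n≤1+n r′) (s≤s⁻¹ r≤)

greedy-a₁ : ∀ {h a} → IsGreedyBh h a → a 1 ≡ 1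
greedy-a₁ {h} {a} greedy@(a₀ , _) =
  greedy-next greedy 0 (subst (_< 1) (sym a₀) (s≤s z≤n)) (candidates-Bh candidates ∋1)
    (λ a₀<y y<1 → contradiction (subst (_< _) a₀ a₀<y) (<⇒≱ y<1))
  where
  candidates : ∀ i → i ≤ 0 → Candidate h (a i)
  candidates zero _ = subst (Candidate h) (sym a₀) ∋0

greedy-a₂ : ∀ {m a} → IsGreedyBh (suc m) a → a 1 ≡ 1 → a 2 ≡ 2 + m
greedy-a₂ {m} {a} greedy@(a₀ , _) a₁ =
  greedy-next greedy 1 (subst (_< 2 + m) (sym a₁) (s≤s (s≤s z≤n))) (candidates-Bh candidates ∋1+h)
    (λ {y} a₁<y y<2+m → ¬Bh-small {prefixWith a 1 y}
       (inj₁ (0 , z≤n , a₀)) (inj₁ (1 , ≤-refl , a₁)) (inj₂ refl)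
       (subst (_< _) a₁ a₁<y) (s≤s⁻¹ y<2+m))
  where
  candidates : ∀ i → i ≤ 1 → Candidate (suc m) (a i)
  candidates 0 _ = subst (Candidate (suc m)) (sym a₀) ∋0
  candidates 1 _ = subst (Candidate (suc m)) (sym a₁) ∋1
  candidates (suc (suc _)) (s≤s ())

greedy-a₃ : ∀ {m a} → IsGreedyBh (suc m) a → a 1 ≡ 1 → a 2 ≡ 2 + m →
            a 3 ≡ suc m * suc m + suc m + 1
greedy-a₃ {m} {a} greedy@(a₀ , _) a₁ a₂ =
  greedy-next greedy 2 (subst (_< top) (sym a₂) 2+m<top)
    (candidates-Bh candidates ∋h²+h+1)
    (λ {y} a₂<y y<top → ¬Bh-middle {prefixWith a 2 y}
       (inj₁ (0 , z≤n , a₀)) (inj₁ (1 , s≤s z≤n , a₁)) (inj₁ (2 , ≤-refl , a₂)) (inj₂ refl)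
       (subst (_< _) a₂ a₂<y) (s≤s⁻¹ (subst (y <_) top≡ y<top)))
  where
  h = suc m
  top = h * h + h + 1
  top≡ : top ≡ suc (h * suc h)
  top≡ = n*n+n+1≡1+n*[1+n] h
  2+m<top : 2 + m < top
  2+m<top = ≤-<-trans (m≤n*m (2 + m) h) (n*[1+n]<n*n+n+1 h)
  candidates : ∀ i → i ≤ 2 → Candidate h (a i)
  candidates 0 _ = subst (Candidate h) (sym a₀) ∋0
  candidates 1 _ = subst (Candidate h) (sym a₁) ∋1
  candidates 2 _ = subst (Candidate h) (sym a₂) ∋1+h
  candidates (suc (suc (suc _))) (s≤s (s≤s ()))

theorem4 : ∀ (h : ℕ) → 1 ≤ h → (a : ℕ → ℕ) → IsGreedyBh h a →
    a 3 ≡ h * h + h + 1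
theorem4 (suc m) _ a greedy = greedy-a₃ greedy a₁ (greedy-a₂ greedy a₁)
  where
  a₁ : a 1 ≡ 1
  a₁ = greedy-a₁ greedy
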